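{- Let $S=B\sqcup D\subseteq\mathbb{F}_2^n$ be finite, where $B$ is an affine basis for $S$, and let $\varphi:\mathcal{P}(D)\to E(S)$ be the sumset map induced by $B$. Let $D',D_1,D_2\subseteq D$. Then (1) $D\cap\varphi(D')=D'$; (2) if $D_1\cap D_2=\varnothing$ then $\varphi(D_1\cup D_2)=\varphi(D_1)\triangle\varphi(D_2)$; (3) $\varphi$ is bijective and linear.
   Context: An affine basis for $S$ is an affinely independent subset $B=\{\vec b_0,\dots,\vec b_d\}\subseteq S$ whose affine span equals that of $S$; in $\mathbb{F}_2^n$ affine combinations are sums of an odd number of points, so each $\vec w\in D=S\setminus B$ has a unique expression $\vec w=\vec b_{i_1}+\dots+\vec b_{i_j}$ with $j$ odd and distinct indices. Set $X_{\vec w}=\{\vec w,\vec b_{i_1},\dots,\vec b_{i_j}\}$. $E(S)$ is the set of even-size subsets of $S$ summing to $\vec 0$ (including $\varnothing$), a subspace of $\mathcal{P}(S)$, which is an $\mathbb{F}_2$-vector space under symmetric difference $\triangle$. The sumset map is $\varphi(\varnothing)=\varnothing$ and $\varphi(D')=\triangle_{\vec w\in D'}X_{\vec w}$ for nonempty $D'\subseteq D$. -}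

module Defs where

open import Data.Nat using (ℕ; zero; suc)
open import Data.Nat.Divisibility using (_∣_)
open import Data.Bool using (Bool; true; false; if_then_else_; _xor_)
open import Data.Vec using (Vec; []; _∷_; replicate; zipWith)
open import Data.Fin using (Fin; zero; suc)
open import Data.Fin.Subset using (Subset; _⊆_; _∪_; ⁅_⁆; ∣_∣; _∈_; ∁; ⊥)
open import Data.Product using (Σ; _×_; ∃; _,_)
open import Function using (_∘_; Injective)
open import Relation.Binary.PropositionalEquality using (_≡_)
open import Relation.Nullary using (¬_)

𝔽₂^ : ℕ → Set
𝔽₂^ n = Vec Bool n

𝟎 : ∀ {n} → 𝔽₂^ n
𝟎 = replicate _ false

infixl 6 _⊕_
_⊕_ : ∀ {n} → 𝔽₂^ n → 𝔽₂^ n → 𝔽₂^ n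
_⊕_ = zipWith _xor_

infixl 6 _△_
_△_ : ∀ {m} → Subset m → Subset m → Subset m
_△_ = zipWith _xor_

IsEven : ℕ → Set
IsEven k = 2 ∣ k

IsOdd : ℕ → Set
IsOdd k = ¬ (2 ∣ k)

-- A finite set S ⊆ 𝔽₂ⁿ with m elements is given by an injective enumeration
-- pts : Fin m → 𝔽₂ⁿ; subsets of S are subsets of Fin m.
-- Sum of the points of S indexed by a subset U.
sumOf : ∀ {m n} → (Fin m → 𝔽₂^ n) → Subset m → 𝔽₂^ n
sumOf {zero}  pts []      = 𝟎
sumOf {suc m} pts (b ∷ U) = (if b then pts zero else 𝟎) ⊕ sumOf (pts ∘ suc) U

InAffSpan : ∀ {m n} → (Fin m → 𝔽₂^ n) → Subset m → 𝔽₂^ n → Set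
InAffSpan pts T v = Σ (Subset _) λ U → U ⊆ T × IsOdd ∣ U ∣ × sumOf pts U ≡ v

AffInd : ∀ {m n} → (Fin m → 𝔽₂^ n) → Subset m → Set
AffInd pts T = ∀ U → U ⊆ T → IsEven ∣ U ∣ → sumOf pts U ≡ 𝟎 → U ≡ ⊥

IsAffineBasis : ∀ {m n} → (Fin m → 𝔽₂^ n) → Subset m → Set
IsAffineBasis {m} {n} pts B =
  AffInd pts B × (∀ (v : 𝔽₂^ n) → (InAffSpan pts B v → InAffSpan pts (Data.Fin.Subset.⊤) v)
                                  × (InAffSpan pts (Data.Fin.Subset.⊤) v → InAffSpan pts B v))

InE : ∀ {m n} → (Fin m → 𝔽₂^ n) → Subset m → Set
InE pts T = IsEven ∣ T ∣ × sumOf pts T ≡ 𝟎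

-- rep w is an expression of w ∈ D = S ∖ B as a sum of an odd number of
-- distinct basis points (such an expression exists and is unique when B is
-- an affine basis; the statement quantifies over this representation data).
IsBasisRep : ∀ {m n} → (Fin m → 𝔽₂^ n) → Subset m → (Fin m → Subset m) → Set
IsBasisRep pts B rep =
  ∀ w → w ∈ ∁ B → rep w ⊆ B × IsOdd ∣ rep w ∣ × sumOf pts (rep w) ≡ pts w

X : ∀ {m} → (Fin m → Subset m) → Fin m → Subset m
X rep w = ⁅ w ⁆ ∪ rep w

bigΔ : ∀ {m k} → (Fin m → Subset k) → Subset m → Subset k
bigΔ {zero}  F []      = ⊥
bigΔ {suc m} F (b ∷ U) = (if b then F zero else ⊥) △ bigΔ (F ∘ suc) U

φ : ∀ {m} → (Fin m → Subset m) → Subset m → Subset m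
φ rep D' = bigΔ (X rep) D'

-- 𝒫(S) under △ is an 𝔽₂-vector space and φ is the linear map sending the
-- basis vector {w} of 𝒫(D) to X_w.  Every X_w lies in E(S), a subspace, so φ
-- lands in E(S).  Since X_w ∩ D = {w}, intersecting with D is a left inverse
-- of φ, which gives (1) and injectivity.  For T ∈ E(S), the difference
-- T △ φ(D ∩ T) lies in E(S) and avoids D, so it is an affine dependency among
-- the points of B and is therefore empty: φ is onto.
module Submission where

open import Defs
open import Data.Nat using (ℕ; zero; suc; _*_)
open import Data.Nat.Divisibility using (divides)
open import Data.Bool using (Bool; true; false; not; _xor_; if_then_else_)
open import Data.Bool.Properties
  using (not-involutive; xor-assoc; xor-identityˡ; xor-identityʳ; xor-same;
         ∧-zeroʳ; ∧-distribˡ-xor; xor-∧-commutativeRing)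
open import Data.Vec using ([]; _∷_; tail; here; there)
open import Data.Vec.Properties
  using (zipWith-assoc; zipWith-identityˡ; zipWith-identityʳ; zipWith-distribˡ)
open import Data.Fin using (Fin; zero; suc)
open import Data.Fin.Subset using (Subset; _⊆_; _∩_; _∪_; ∁; ⊥; ⁅_⁆; ∣_∣; _∈_)
open import Data.Fin.Subset.Properties
  using (∩-zeroʳ; ∪-identityʳ; ∩-distribˡ-∪; Empty-unique; ∉⊥; x∈p∩q⁺; x∈p∩q⁻; p∩q⊆p;
         x∈∁p⇒x∉p; x∉∁p⇒x∈p; x∈⁅y⁆⇒x≡y; ⊆-refl)
open import Data.Product using (Σ; _×_; _,_; proj₁; proj₂)
open import Data.Empty using (⊥-elim)
open import Function using (_∘_; Injective)
open import Relation.Binary.PropositionalEquality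
  using (_≡_; refl; sym; trans; cong; cong₂; subst; module ≡-Reasoning)
open import Algebra.Bundles using (CommutativeRing)
open import Algebra.Properties.CommutativeSemigroup
  (CommutativeRing.+-commutativeSemigroup xor-∧-commutativeRing)
  renaming (interchange to xor-interchange)
  using ()

private
  variable
    k m : ℕ

△-assoc : (p q r : Subset k) → (p △ q) △ r ≡ p △ (q △ r)
△-assoc = zipWith-assoc xor-assoc

△-identityˡ : (p : Subset k) → ⊥ △ p ≡ p
△-identityˡ = zipWith-identityˡ xor-identityˡ

△-identityʳ : (p : Subset k) → p △ ⊥ ≡ p
△-identityʳ = zipWith-identityʳ xor-identityʳ

△-same : (p : Subset k) → p △ p ≡ ⊥
△-same []      = refl
△-same (b ∷ p) = cong₂ _∷_ (xor-same b) (△-same p)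

△-interchange : (p q r s : Subset k) → (p △ q) △ (r △ s) ≡ (p △ r) △ (q △ s)
△-interchange []      []      []      []      = refl
△-interchange (a ∷ p) (b ∷ q) (c ∷ r) (d ∷ s) =
  cong₂ _∷_ (xor-interchange a b c d) (△-interchange p q r s)

p△q≡⊥⇒p≡q : (p q : Subset k) → p △ q ≡ ⊥ → p ≡ q
p△q≡⊥⇒p≡q p q p△q≡⊥ = begin
  p             ≡⟨ sym (△-identityʳ p) ⟩
  p △ ⊥         ≡⟨ cong (p △_) (sym (△-same q)) ⟩
  p △ (q △ q)   ≡⟨ sym (△-assoc p q q) ⟩
  (p △ q) △ q   ≡⟨ cong (_△ q) p△q≡⊥ ⟩
  ⊥ △ q         ≡⟨ △-identityˡ q ⟩
  q             ∎
  where open ≡-Reasoning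

∩-distribˡ-△ : (p q r : Subset k) → p ∩ (q △ r) ≡ (p ∩ q) △ (p ∩ r)
∩-distribˡ-△ = zipWith-distribˡ ∧-distribˡ-xor

p∩q≡⊥⇒p∪q≡p△q : (p q : Subset k) → p ∩ q ≡ ⊥ → p ∪ q ≡ p △ q
p∩q≡⊥⇒p∪q≡p△q []          []          _  = refl
p∩q≡⊥⇒p∪q≡p△q (true  ∷ p) (true  ∷ q) ()
p∩q≡⊥⇒p∪q≡p△q (true  ∷ p) (false ∷ q) eq = cong (true ∷_) (p∩q≡⊥⇒p∪q≡p△q p q (cong tail eq))
p∩q≡⊥⇒p∪q≡p△q (false ∷ p) (b     ∷ q) eq = cong (b ∷_) (p∩q≡⊥⇒p∪q≡p△q p q (cong tail eq))

x∈p⇒⁅x⁆⊆p : {x : Fin k} {p : Subset k} → x ∈ p → ⁅ x ⁆ ⊆ p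
x∈p⇒⁅x⁆⊆p {x = x} {p} x∈p y∈⁅x⁆ = subst (_∈ p) (sym (x∈⁅y⁆⇒x≡y x y∈⁅x⁆)) x∈p

x∈p⇒p∩⁅x⁆≡⁅x⁆ : {x : Fin k} {p : Subset k} → x ∈ p → p ∩ ⁅ x ⁆ ≡ ⁅ x ⁆
x∈p⇒p∩⁅x⁆≡⁅x⁆ {p = true ∷ p} here        = cong (true ∷_) (∩-zeroʳ p)
x∈p⇒p∩⁅x⁆≡⁅x⁆ {p = b ∷ p}    (there x∈p) = cong₂ _∷_ (∧-zeroʳ b) (x∈p⇒p∩⁅x⁆≡⁅x⁆ x∈p)

p⊆∁r⇒q⊆r⇒p∩q≡⊥ : {p q r : Subset k} → p ⊆ ∁ r → q ⊆ r → p ∩ q ≡ ⊥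
p⊆∁r⇒q⊆r⇒p∩q≡⊥ {p = p} {q} p⊆∁r q⊆r = Empty-unique λ (x , x∈p∩q) →
  let x∈p , x∈q = x∈p∩q⁻ p q x∈p∩q in x∈∁p⇒x∉p (p⊆∁r x∈p) (q⊆r x∈q)

∁p∩q≡⊥⇒q⊆p : {p q : Subset k} → ∁ p ∩ q ≡ ⊥ → q ⊆ p
∁p∩q≡⊥⇒q⊆p {p = p} {q} ∁p∩q≡⊥ {x} x∈q =
  x∉∁p⇒x∈p λ x∈∁p → ∉⊥ (subst (x ∈_) ∁p∩q≡⊥ (x∈p∩q⁺ (x∈∁p , x∈q)))

if-xor-△ : ∀ a b (p : Subset k) →
  (if a xor b then p else ⊥) ≡ (if a then p else ⊥) △ (if b then p else ⊥)
if-xor-△ true  true  p = sym (△-same p)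
if-xor-△ true  false p = sym (△-identityʳ p)
if-xor-△ false true  p = sym (△-identityˡ p)
if-xor-△ false false p = sym (△-identityˡ ⊥)

bigΔ-⊥ : (F : Fin m → Subset k) → bigΔ F ⊥ ≡ ⊥
bigΔ-⊥ {zero}  F = refl
bigΔ-⊥ {suc m} F = trans (cong (⊥ △_) (bigΔ-⊥ (F ∘ suc))) (△-identityˡ ⊥)

bigΔ-⁅⁆ : (F : Fin m → Subset k) (i : Fin m) → bigΔ F ⁅ i ⁆ ≡ F i
bigΔ-⁅⁆ F zero    = trans (cong (F zero △_) (bigΔ-⊥ (F ∘ suc))) (△-identityʳ (F zero))
bigΔ-⁅⁆ F (suc i) = trans (△-identityˡ _) (bigΔ-⁅⁆ (F ∘ suc) i)

bigΔ-△ : (F : Fin m → Subset k) (p q : Subset m) → bigΔ F (p △ q) ≡ bigΔ F p △ bigΔ F q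
bigΔ-△ {zero}  F []      []      = sym (△-identityˡ ⊥)
bigΔ-△ {suc m} F (a ∷ p) (b ∷ q) = begin
  (if a xor b then F zero else ⊥) △ bigΔ (F ∘ suc) (p △ q)
    ≡⟨ cong₂ _△_ (if-xor-△ a b (F zero)) (bigΔ-△ (F ∘ suc) p q) ⟩
  ((if a then F zero else ⊥) △ (if b then F zero else ⊥)) △ (bigΔ (F ∘ suc) p △ bigΔ (F ∘ suc) q)
    ≡⟨ △-interchange _ _ _ _ ⟩
  ((if a then F zero else ⊥) △ bigΔ (F ∘ suc) p) △ ((if b then F zero else ⊥) △ bigΔ (F ∘ suc) q)
    ∎
  where open ≡-Reasoning

bigΔ-cong : {F G : Fin m → Subset k} (p : Subset m) → (∀ {i} → i ∈ p → F i ≡ G i) →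
  bigΔ F p ≡ bigΔ G p
bigΔ-cong {zero}  []          F≗G = refl
bigΔ-cong {suc m} (true  ∷ p) F≗G = cong₂ _△_ (F≗G here) (bigΔ-cong p (F≗G ∘ there))
bigΔ-cong {suc m} (false ∷ p) F≗G = cong (⊥ △_) (bigΔ-cong p (F≗G ∘ there))

bigΔ-map : ∀ {j} (f : Subset k → Subset j) → f ⊥ ≡ ⊥ → (∀ p q → f (p △ q) ≡ f p △ f q) →
  (F : Fin m → Subset k) (p : Subset m) → f (bigΔ F p) ≡ bigΔ (f ∘ F) p
bigΔ-map {m = zero}  f f⊥ f△ F []      = f⊥
bigΔ-map {m = suc m} f f⊥ f△ F (b ∷ p) =
  trans (f△ _ _) (cong₂ _△_ (f-if b) (bigΔ-map f f⊥ f△ (F ∘ suc) p))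
  where
  f-if : ∀ b → f (if b then F zero else ⊥) ≡ (if b then f (F zero) else ⊥)
  f-if true  = refl
  f-if false = f⊥

bigΔ-closed : (P : Subset k → Set) → P ⊥ → (∀ {p q} → P p → P q → P (p △ q)) →
  (F : Fin m → Subset k) (p : Subset m) → (∀ {i} → i ∈ p → P (F i)) → P (bigΔ F p)
bigΔ-closed {m = zero}  P P⊥ P△ F []          PF = P⊥
bigΔ-closed {m = suc m} P P⊥ P△ F (true  ∷ p) PF =
  P△ (PF here) (bigΔ-closed P P⊥ P△ (F ∘ suc) p (PF ∘ there))
bigΔ-closed {m = suc m} P P⊥ P△ F (false ∷ p) PF =
  P△ P⊥ (bigΔ-closed P P⊥ P△ (F ∘ suc) p (PF ∘ there))

bigΔ-singletons : (p : Subset m) → bigΔ ⁅_⁆ p ≡ p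
bigΔ-singletons {zero}  []      = refl
bigΔ-singletons {suc m} (b ∷ p) = begin
  (if b then ⁅ zero ⁆ else ⊥) △ bigΔ ((false ∷_) ∘ ⁅_⁆) p
    ≡⟨ cong (_ △_) (sym (bigΔ-map (false ∷_) refl (λ _ _ → refl) ⁅_⁆ p)) ⟩
  (if b then ⁅ zero ⁆ else ⊥) △ (false ∷ bigΔ ⁅_⁆ p)
    ≡⟨ cong (λ q → (if b then ⁅ zero ⁆ else ⊥) △ (false ∷ q)) (bigΔ-singletons p) ⟩
  (if b then ⁅ zero ⁆ else ⊥) △ (false ∷ p)
    ≡⟨ cons-△ b ⟩
  b ∷ p
    ∎
  where
  open ≡-Reasoning
  cons-△ : ∀ b → (if b then ⁅ zero ⁆ else ⊥) △ (false ∷ p) ≡ b ∷ p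
  cons-△ true  = cong (true ∷_) (△-identityˡ p)
  cons-△ false = cong (false ∷_) (△-identityˡ p)

parity : Subset k → Bool
parity []      = false
parity (b ∷ p) = b xor parity p

parity-△ : (p q : Subset k) → parity (p △ q) ≡ parity p xor parity q
parity-△ []      []      = refl
parity-△ (a ∷ p) (b ∷ q) =
  trans (cong ((a xor b) xor_) (parity-△ p q)) (xor-interchange a b (parity p) (parity q))

parity-⊥ : parity (⊥ {k}) ≡ false
parity-⊥ {zero}  = refl
parity-⊥ {suc k} = parity-⊥ {k}

parity-⁅⁆ : (i : Fin k) → parity ⁅ i ⁆ ≡ true
parity-⁅⁆ {suc k} zero    = cong not (parity-⊥ {k})
parity-⁅⁆         (suc i) = parity-⁅⁆ i

odd? : ℕ → Bool
odd? zero    = false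
odd? (suc n) = not (odd? n)

parity≡odd?∣p∣ : (p : Subset k) → parity p ≡ odd? ∣ p ∣
parity≡odd?∣p∣ []          = refl
parity≡odd?∣p∣ (true  ∷ p) = cong not (parity≡odd?∣p∣ p)
parity≡odd?∣p∣ (false ∷ p) = parity≡odd?∣p∣ p

even⇒odd?≡false : ∀ n → IsEven n → odd? n ≡ false
even⇒odd?≡false .(q * 2) (divides q refl) = odd?-double q
  where
  odd?-double : ∀ q → odd? (q * 2) ≡ false
  odd?-double zero    = refl
  odd?-double (suc q) = trans (not-involutive _) (odd?-double q)

odd?≡false⇒even : ∀ n → odd? n ≡ false → IsEven n
odd?≡false⇒even zero          _  = divides 0 refl
odd?≡false⇒even (suc zero)    ()
odd?≡false⇒even (suc (suc n)) eq with odd?≡false⇒even n (trans (sym (not-involutive _)) eq)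
... | divides q n≡q*2 = divides (suc q) (cong (λ (x : ℕ) → suc (suc x)) n≡q*2)

odd⇒odd?≡true : ∀ n → IsOdd n → odd? n ≡ true
odd⇒odd?≡true n odd with odd? n in eq
... | true  = refl
... | false = ⊥-elim (odd (odd?≡false⇒even n eq))

even⇒parity≡false : (p : Subset k) → IsEven ∣ p ∣ → parity p ≡ false
even⇒parity≡false p p-even = trans (parity≡odd?∣p∣ p) (even⇒odd?≡false _ p-even)

odd⇒parity≡true : (p : Subset k) → IsOdd ∣ p ∣ → parity p ≡ true
odd⇒parity≡true p p-odd = trans (parity≡odd?∣p∣ p) (odd⇒odd?≡true _ p-odd)

parity≡false⇒even : (p : Subset k) → parity p ≡ false → IsEven ∣ p ∣
parity≡false⇒even p eq = odd?≡false⇒even _ (trans (sym (parity≡odd?∣p∣ p)) eq)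

parity≡⇒even-△ : (p q : Subset k) → parity p ≡ parity q → IsEven ∣ p △ q ∣
parity≡⇒even-△ p q eq = parity≡false⇒even (p △ q) (begin
  parity (p △ q)          ≡⟨ parity-△ p q ⟩
  parity p xor parity q   ≡⟨ cong (_xor parity q) eq ⟩
  parity q xor parity q   ≡⟨ xor-same (parity q) ⟩
  false                   ∎)
  where open ≡-Reasoning

sumOf≡bigΔ : ∀ {n} (pts : Fin m → 𝔽₂^ n) (p : Subset m) → sumOf pts p ≡ bigΔ pts p
sumOf≡bigΔ {zero}  pts []      = refl
sumOf≡bigΔ {suc m} pts (b ∷ p) = cong (_ △_) (sumOf≡bigΔ (pts ∘ suc) p)

module _ {n} (pts : Fin m → 𝔽₂^ n) where

  sumOf-△ : (p q : Subset m) → sumOf pts (p △ q) ≡ sumOf pts p ⊕ sumOf pts q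
  sumOf-△ p q = begin
    sumOf pts (p △ q)             ≡⟨ sumOf≡bigΔ pts (p △ q) ⟩
    bigΔ pts (p △ q)              ≡⟨ bigΔ-△ pts p q ⟩
    bigΔ pts p △ bigΔ pts q       ≡⟨ sym (cong₂ _△_ (sumOf≡bigΔ pts p) (sumOf≡bigΔ pts q)) ⟩
    sumOf pts p ⊕ sumOf pts q     ∎
    where open ≡-Reasoning

  sumOf-⁅⁆ : (i : Fin m) → sumOf pts ⁅ i ⁆ ≡ pts i
  sumOf-⁅⁆ i = trans (sumOf≡bigΔ pts ⁅ i ⁆) (bigΔ-⁅⁆ pts i)

  InE-⊥ : InE pts ⊥
  InE-⊥ = parity≡false⇒even (⊥ {m}) (parity-⊥ {m}) , trans (sumOf≡bigΔ pts ⊥) (bigΔ-⊥ pts)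

  InE-△ : {p q : Subset m} → InE pts p → InE pts q → InE pts (p △ q)
  InE-△ {p} {q} (p-even , Σp≡𝟎) (q-even , Σq≡𝟎) =
      parity≡⇒even-△ p q (trans (even⇒parity≡false p p-even) (sym (even⇒parity≡false q q-even)))
    , (begin
      sumOf pts (p △ q)             ≡⟨ sumOf-△ p q ⟩
      sumOf pts p ⊕ sumOf pts q     ≡⟨ cong₂ _⊕_ Σp≡𝟎 Σq≡𝟎 ⟩
      𝟎 ⊕ 𝟎                         ≡⟨ △-same 𝟎 ⟩
      𝟎                             ∎)
    where open ≡-Reasoning

φ-△ : (rep : Fin m → Subset m) (D₁ D₂ : Subset m) → φ rep (D₁ △ D₂) ≡ φ rep D₁ △ φ rep D₂
φ-△ rep = bigΔ-△ (X rep)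

φ-∪ : (rep : Fin m → Subset m) (D₁ D₂ : Subset m) → D₁ ∩ D₂ ≡ ⊥ →
  φ rep (D₁ ∪ D₂) ≡ φ rep D₁ △ φ rep D₂
φ-∪ rep D₁ D₂ disjoint = trans (cong (φ rep) (p∩q≡⊥⇒p∪q≡p△q D₁ D₂ disjoint)) (φ-△ rep D₁ D₂)

module _ {n} (pts : Fin m → 𝔽₂^ n) (B : Subset m)
         (rep : Fin m → Subset m) (isRep : IsBasisRep pts B rep) where

  rep⊆B : ∀ {w} → w ∈ ∁ B → rep w ⊆ B
  rep⊆B w∈D = proj₁ (isRep _ w∈D)

  X≡⁅⁆△rep : ∀ {w} → w ∈ ∁ B → X rep w ≡ ⁅ w ⁆ △ rep w
  X≡⁅⁆△rep {w} w∈D =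
    p∩q≡⊥⇒p∪q≡p△q ⁅ w ⁆ (rep w) (p⊆∁r⇒q⊆r⇒p∩q≡⊥ (x∈p⇒⁅x⁆⊆p w∈D) (rep⊆B w∈D))

  X∈E : ∀ {w} → w ∈ ∁ B → InE pts (X rep w)
  X∈E {w} w∈D = subst (InE pts) (sym (X≡⁅⁆△rep w∈D)) (⁅w⁆△rep-even , Σ⁅w⁆△rep≡𝟎)
    where
    open ≡-Reasoning
    rep-odd : IsOdd ∣ rep w ∣
    rep-odd = proj₁ (proj₂ (isRep w w∈D))
    Σrep≡w : sumOf pts (rep w) ≡ pts w
    Σrep≡w = proj₂ (proj₂ (isRep w w∈D))
    ⁅w⁆△rep-even : IsEven ∣ ⁅ w ⁆ △ rep w ∣
    ⁅w⁆△rep-even = parity≡⇒even-△ ⁅ w ⁆ (rep w)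
      (trans (parity-⁅⁆ w) (sym (odd⇒parity≡true (rep w) rep-odd)))
    Σ⁅w⁆△rep≡𝟎 : sumOf pts (⁅ w ⁆ △ rep w) ≡ 𝟎
    Σ⁅w⁆△rep≡𝟎 = begin
      sumOf pts (⁅ w ⁆ △ rep w)              ≡⟨ sumOf-△ pts ⁅ w ⁆ (rep w) ⟩
      sumOf pts ⁅ w ⁆ ⊕ sumOf pts (rep w)    ≡⟨ cong₂ _⊕_ (sumOf-⁅⁆ pts w) Σrep≡w ⟩
      pts w ⊕ pts w                          ≡⟨ △-same (pts w) ⟩
      𝟎                                      ∎

  ∁B∩X≡⁅⁆ : ∀ {w} → w ∈ ∁ B → ∁ B ∩ X rep w ≡ ⁅ w ⁆
  ∁B∩X≡⁅⁆ {w} w∈D = begin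
    ∁ B ∩ (⁅ w ⁆ ∪ rep w)           ≡⟨ ∩-distribˡ-∪ (∁ B) ⁅ w ⁆ (rep w) ⟩
    (∁ B ∩ ⁅ w ⁆) ∪ (∁ B ∩ rep w)   ≡⟨ cong₂ _∪_ (x∈p⇒p∩⁅x⁆≡⁅x⁆ w∈D)
                                                (p⊆∁r⇒q⊆r⇒p∩q≡⊥ ⊆-refl (rep⊆B w∈D)) ⟩
    ⁅ w ⁆ ∪ ⊥                       ≡⟨ ∪-identityʳ ⁅ w ⁆ ⟩
    ⁅ w ⁆                           ∎
    where open ≡-Reasoning

  ∁B∩φ : ∀ {D′} → D′ ⊆ ∁ B → ∁ B ∩ φ rep D′ ≡ D′
  ∁B∩φ {D′} D′⊆D = begin
    ∁ B ∩ bigΔ (X rep) D′           ≡⟨ bigΔ-map (∁ B ∩_) (∩-zeroʳ (∁ B)) (∩-distribˡ-△ (∁ B))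
                                                (X rep) D′ ⟩
    bigΔ (λ w → ∁ B ∩ X rep w) D′   ≡⟨ bigΔ-cong D′ (∁B∩X≡⁅⁆ ∘ D′⊆D) ⟩
    bigΔ ⁅_⁆ D′                     ≡⟨ bigΔ-singletons D′ ⟩
    D′                              ∎
    where open ≡-Reasoning

  φ∈E : ∀ {D′} → D′ ⊆ ∁ B → InE pts (φ rep D′)
  φ∈E {D′} D′⊆D = bigΔ-closed (InE pts) (InE-⊥ pts) (InE-△ pts) (X rep) D′ (X∈E ∘ D′⊆D)

  φ-injective : ∀ {D₁ D₂} → D₁ ⊆ ∁ B → D₂ ⊆ ∁ B → φ rep D₁ ≡ φ rep D₂ → D₁ ≡ D₂
  φ-injective D₁⊆D D₂⊆D φD₁≡φD₂ =
    trans (sym (∁B∩φ D₁⊆D)) (trans (cong (∁ B ∩_) φD₁≡φD₂) (∁B∩φ D₂⊆D))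

  φ-surjective : AffInd pts B → ∀ {T} → InE pts T →
    Σ (Subset m) λ D′ → D′ ⊆ ∁ B × φ rep D′ ≡ T
  φ-surjective indep {T} T∈E = D′ , D′⊆D , sym (p△q≡⊥⇒p≡q T (φ rep D′) W≡⊥)
    where
    D′ = ∁ B ∩ T
    D′⊆D : D′ ⊆ ∁ B
    D′⊆D = p∩q⊆p (∁ B) T
    W = T △ φ rep D′
    W∈E : InE pts W
    W∈E = InE-△ pts T∈E (φ∈E D′⊆D)
    ∁B∩W≡⊥ : ∁ B ∩ W ≡ ⊥
    ∁B∩W≡⊥ = begin
      ∁ B ∩ (T △ φ rep D′)    ≡⟨ ∩-distribˡ-△ (∁ B) T (φ rep D′) ⟩
      D′ △ (∁ B ∩ φ rep D′)   ≡⟨ cong (D′ △_) (∁B∩φ D′⊆D) ⟩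
      D′ △ D′                 ≡⟨ △-same D′ ⟩
      ⊥                       ∎
      where open ≡-Reasoning
    W≡⊥ : W ≡ ⊥
    W≡⊥ = indep W (∁p∩q≡⊥⇒q⊆p ∁B∩W≡⊥) (proj₁ W∈E) (proj₂ W∈E)

lemma5p3 : ∀ {m n} (pts : Fin m → 𝔽₂^ n) → Injective _≡_ _≡_ pts →
    (B : Subset m) → IsAffineBasis pts B →
    (rep : Fin m → Subset m) → IsBasisRep pts B rep →
    (∀ D′ → D′ ⊆ ∁ B → ∁ B ∩ φ rep D′ ≡ D′)
    × (∀ D₁ D₂ → D₁ ⊆ ∁ B → D₂ ⊆ ∁ B → D₁ ∩ D₂ ≡ ⊥ →
         φ rep (D₁ ∪ D₂) ≡ φ rep D₁ △ φ rep D₂)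
    × (∀ D′ → D′ ⊆ ∁ B → InE pts (φ rep D′))
    × (∀ D₁ D₂ → D₁ ⊆ ∁ B → D₂ ⊆ ∁ B → φ rep D₁ ≡ φ rep D₂ → D₁ ≡ D₂)
    × (∀ T → InE pts T → Σ (Subset m) λ D′ → D′ ⊆ ∁ B × φ rep D′ ≡ T)
    × (∀ D₁ D₂ → D₁ ⊆ ∁ B → D₂ ⊆ ∁ B →
         φ rep (D₁ △ D₂) ≡ φ rep D₁ △ φ rep D₂)
lemma5p3 pts _ B (indep , _) rep isRep =
    (λ _ → ∁B∩φ pts B rep isRep)
  , (λ D₁ D₂ _ _ → φ-∪ rep D₁ D₂)
  , (λ _ → φ∈E pts B rep isRep)
  , (λ _ _ → φ-injective pts B rep isRep)
  , (λ _ → φ-surjective pts B rep isRep indep)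
  , (λ D₁ D₂ _ _ → φ-△ rep D₁ D₂)
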